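{- If $G$ is a simple connected finite graph on $3$ or more vertices, then $|E(G)|< h(T(G))$.
   Context: The total graph $T(G)$ has vertex set $V(G)\cup E(G)$, two elements being adjacent in $T(G)$ if and only if they are adjacent or incident in $G$ (two vertices adjacent in $G$, two edges sharing an endpoint, or a vertex and an edge incident to it). The primitive hole number $h(H)$ of a graph $H$ is the number of triangles (cycles $C_3$) in $H$, with $h(H)=0$ if there are none. -}

module Defs where

open import Data.Bool using (Bool; true; false; _∧_; _∨_; not; if_then_else_)
open import Data.Nat using (ℕ; suc; _<ᵇ_; _+_)
open import Data.Fin using (Fin; toℕ; splitAt)
open import Data.Fin.Properties using (_≟_)
open import Data.List using (List; []; _∷_; [_]; length; concatMap; allFin; lookup)
open import Data.Product using (_×_; _,_)
open import Data.Sum using (inj₁; inj₂)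
open import Relation.Nullary.Decidable using (⌊_⌋)
open import Relation.Binary.PropositionalEquality using (_≡_)

record SimpleGraph (n : ℕ) : Set where
  field
    adj    : Fin n → Fin n → Bool
    sym    : ∀ u v → adj u v ≡ adj v u
    irrefl : ∀ v → adj v v ≡ false
open SimpleGraph public

data Reachable {n : ℕ} (G : SimpleGraph n) : Fin n → Fin n → Set where
  here : ∀ {u} → Reachable G u u
  step : ∀ {u v w} → adj G u v ≡ true → Reachable G v w → Reachable G u w

Connected : ∀ {n} → SimpleGraph n → Set
Connected G = ∀ u v → Reachable G u v

-- The edge set E(G): each edge {i,j} listed once as the pair (i , j) with i < j.
edges : ∀ {n} → SimpleGraph n → List (Fin n × Fin n)
edges {n} G =
  concatMap (λ i → concatMap (λ j →
      if (toℕ i <ᵇ toℕ j) ∧ adj G i j then [ (i , j) ] else [])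
    (allFin n)) (allFin n)

numEdges : ∀ {n} → SimpleGraph n → ℕ
numEdges G = length (edges G)

triangles : ∀ {N} → (Fin N → Fin N → Bool) → List (Fin N × Fin N × Fin N)
triangles {N} a =
  concatMap (λ i → concatMap (λ j → concatMap (λ k →
      if (toℕ i <ᵇ toℕ j) ∧ (toℕ j <ᵇ toℕ k) ∧ a i j ∧ a j k ∧ a i k
      then [ (i , j , k) ] else [])
    (allFin N)) (allFin N)) (allFin N)

h : ∀ {N} → (Fin N → Fin N → Bool) → ℕ
h a = length (triangles a)

_==_ : ∀ {n} → Fin n → Fin n → Bool
u == v = ⌊ u ≟ v ⌋

-- Total graph T(G): vertex set V(G) ⊎ E(G), encoded as Fin (n + |E(G)|)
-- (first n indices = vertices, remaining = edges in the order of 'edges G').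
totalAdj : ∀ {n} (G : SimpleGraph n) → Fin (n + numEdges G) → Fin (n + numEdges G) → Bool
totalAdj {n} G x y with splitAt n x | splitAt n y
... | inj₁ u | inj₁ v = adj G u v
... | inj₁ u | inj₂ e = inc u (lookup (edges G) e)
  where inc : Fin n → Fin n × Fin n → Bool
        inc w (a , b) = (w == a) ∨ (w == b)
... | inj₂ e | inj₁ v = inc v (lookup (edges G) e)
  where inc : Fin n → Fin n × Fin n → Bool
        inc w (a , b) = (w == a) ∨ (w == b)
... | inj₂ e | inj₂ f = not (e == f) ∧ share (lookup (edges G) e) (lookup (edges G) f)
  where share : Fin n × Fin n → Fin n × Fin n → Bool
        share (a , b) (c , d) = (a == c) ∨ (a == d) ∨ (b == c) ∨ (b == d)

module Submission where

-- Every edge of G spans a triangle of the total graph T(G): for an edge e = ab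
-- the elements a, b, e are pairwise adjacent in T(G). These |E(G)| triangles are
-- distinct (their third corner is the edge itself). A connected graph on at
-- least three vertices also has a vertex w with two distinct neighbours a, b;
-- the edges wa, wb together with w form one more triangle, made of one vertex
-- and two edges, hence different from all the edge triangles. So T(G) has at
-- least |E(G)| + 1 triangles.

open import Defs renaming (sym to adj-sym)
open import Data.Nat using (ℕ; suc; s≤s; _≤_; _<_; _+_; _<ᵇ_)
open import Data.Nat.Properties using (<ᵇ⇒<; <⇒<ᵇ; <-≤-trans; m≤m+n; +-monoʳ-<; <-irrefl)
open import Data.Bool using (Bool; true; false; T; not; _∧_; _∨_; if_then_else_)
open import Data.Bool.Properties using (T-∧; T-≡)
open import Data.Fin as Fin using (Fin; zero; toℕ; _↑ˡ_; _↑ʳ_)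
open import Data.Fin.Properties using (toℕ-↑ˡ; toℕ-↑ʳ; splitAt-↑ˡ; splitAt-↑ʳ; ↑ʳ-injective; toℕ<n; injective⇒≤; <-cmp; _≟_)
open import Data.List using (List; []; [_]; length; concatMap; allFin; lookup)
open import Data.List.Relation.Unary.Any as Any using (here; index)
open import Data.List.Relation.Unary.Any.Properties using (lookup-index)
open import Data.List.Membership.Propositional using (_∈_)
open import Data.List.Membership.Propositional.Properties using (∈-concatMap⁺; ∈-concatMap⁻; ∈-allFin; ∈-lookup)
open import Data.Product using (_×_; _,_; proj₁; proj₂; Σ; ∃-syntax)
open import Data.Sum using (_⊎_; inj₁; inj₂)
open import Data.Empty using (⊥-elim)
open import Data.Unit using (tt)
open import Function using (_∘_)
open import Function.Bundles using (Equivalence)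
open import Function.Definitions using (Injective)
open import Relation.Binary.Definitions using (tri<; tri≈; tri>)
open import Relation.Nullary using (¬_; Dec; yes; no)
open import Relation.Nullary.Decidable using (fromWitness; fromWitnessFalse; _⊎-dec_)
open import Relation.Binary.PropositionalEquality using (_≡_; _≢_; refl; sym; trans; cong; subst)

-- Counting: a list containing the image of an injective family indexed by
-- Fin k has length at least k (positions in the list separate the elements).
injection-into-list : ∀ {A : Set} {k} (xs : List A) (f : Fin k → A) →
  (f∈xs : ∀ i → f i ∈ xs) → Injective _≡_ _≡_ f → k ≤ length xs
injection-into-list xs f f∈xs f-inj = injective⇒≤ position-injective
  where
    position-injective : Injective _≡_ _≡_ (index ∘ f∈xs)
    position-injective {i} {j} same-position = f-inj (trans (lookup-index (f∈xs i))
      (trans (cong (lookup xs) same-position) (sym (lookup-index (f∈xs j)))))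

∈-if⁺ : ∀ {B : Set} (c : Bool) {y : B} → T c → y ∈ (if c then [ y ] else [])
∈-if⁺ true _ = here refl

∈-if⁻ : ∀ {B : Set} (c : Bool) {x y : B} → x ∈ (if c then [ y ] else []) → T c × x ≡ y
∈-if⁻ true (here x≡y) = tt , x≡y

∈-concatMap-allFin⁺ : ∀ {B : Set} {n} (f : Fin n → List B) i {x} → x ∈ f i →
  x ∈ concatMap f (allFin n)
∈-concatMap-allFin⁺ f i x∈fi = ∈-concatMap⁺ f (Any.map (λ { refl → x∈fi }) (∈-allFin i))

∈-concatMap-allFin⁻ : ∀ {B : Set} {n} (f : Fin n → List B) {x} →
  x ∈ concatMap f (allFin n) → ∃[ i ] x ∈ f i
∈-concatMap-allFin⁻ f x∈ = Any.satisfied (∈-concatMap⁻ f {xs = allFin _} x∈)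

==-refl : ∀ {n} (u : Fin n) → T (u == u)
==-refl u = fromWitness refl

==-≢ : ∀ {n} {u v : Fin n} → u ≢ v → T (not (u == v))
==-≢ u≢v = fromWitnessFalse u≢v

module EdgeList {n} (G : SimpleGraph n) where
  entries : Fin n → Fin n → List (Fin n × Fin n)
  entries i j = if (toℕ i <ᵇ toℕ j) ∧ adj G i j then [ (i , j) ] else []

  ∈-edges⁺ : ∀ {i j} → toℕ i < toℕ j → T (adj G i j) → (i , j) ∈ edges G
  ∈-edges⁺ {i} {j} i<j ij =
    ∈-concatMap-allFin⁺ _ i (∈-concatMap-allFin⁺ (entries i) j
      (∈-if⁺ _ (Equivalence.from T-∧ (<⇒<ᵇ i<j , ij))))

  ∈-edges⁻ : ∀ {i j} → (i , j) ∈ edges G → toℕ i < toℕ j × T (adj G i j)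
  ∈-edges⁻ p with ∈-concatMap-allFin⁻ _ p
  ... | i , q with ∈-concatMap-allFin⁻ (entries i) q
  ... | j , r with ∈-if⁻ ((toℕ i <ᵇ toℕ j) ∧ adj G i j) r
  ... | c , refl with Equivalence.to T-∧ c
  ... | i<ᵇj , ij = <ᵇ⇒< (toℕ i) (toℕ j) i<ᵇj , ij

∈-triangles : ∀ {N} (a : Fin N → Fin N → Bool) {i j k} →
  toℕ i < toℕ j → toℕ j < toℕ k → T (a i j) → T (a j k) → T (a i k) →
  (i , j , k) ∈ triangles a
∈-triangles a {i} {j} {k} i<j j<k ij jk ik =
  ∈-concatMap-allFin⁺ _ i (∈-concatMap-allFin⁺ _ j (∈-concatMap-allFin⁺ _ k
    (∈-if⁺ _ (conj (<⇒<ᵇ i<j) (conj (<⇒<ᵇ j<k) (conj ij (conj jk ik)))))))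
  where
    conj : ∀ {x y} → T x → T y → T (x ∧ y)
    conj p q = Equivalence.from T-∧ (p , q)

Incident : ∀ {n} → Fin n → Fin n × Fin n → Set
Incident w (a , b) = w ≡ a ⊎ w ≡ b

Joins : ∀ {n} → Fin n × Fin n → Fin n → Fin n → Set
Joins p w a = p ≡ (w , a) ⊎ p ≡ (a , w)

joins⇒incident : ∀ {n} {p : Fin n × Fin n} {w a} → Joins p w a → Incident w p
joins⇒incident (inj₁ refl) = inj₁ refl
joins⇒incident (inj₂ refl) = inj₂ refl

joins-unique : ∀ {n} {p : Fin n × Fin n} {w a b} → w ≢ a → Joins p w a → Joins p w b → a ≡ b
joins-unique w≢a (inj₁ refl) (inj₁ refl) = refl
joins-unique w≢a (inj₁ refl) (inj₂ refl) = ⊥-elim (w≢a refl)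
joins-unique w≢a (inj₂ refl) (inj₁ refl) = ⊥-elim (w≢a refl)
joins-unique w≢a (inj₂ refl) (inj₂ refl) = refl

∨-introˡ : ∀ {x} y → T x → T (x ∨ y)
∨-introˡ {true} y _ = tt

∨-introʳ : ∀ x {y} → T y → T (x ∨ y)
∨-introʳ true _ = tt
∨-introʳ false p = p

incident⇒test : ∀ {n} {w a b : Fin n} → Incident w (a , b) → T ((w == a) ∨ (w == b))
incident⇒test {w = w} {b = b} (inj₁ refl) = ∨-introˡ (w == b) (==-refl w)
incident⇒test {w = w} {a = a} (inj₂ refl) = ∨-introʳ (w == a) (==-refl w)

common-endpoint⇒test : ∀ {n} {w a b c d : Fin n} → Incident w (a , b) → Incident w (c , d) →
  T ((a == c) ∨ (a == d) ∨ (b == c) ∨ (b == d))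
common-endpoint⇒test {a = a} (inj₁ refl) (inj₁ refl) = ∨-introˡ _ (==-refl a)
common-endpoint⇒test {a = a} {c = c} (inj₁ refl) (inj₂ refl) =
  ∨-introʳ (a == c) (∨-introˡ _ (==-refl a))
common-endpoint⇒test {a = a} {b = b} {d = d} (inj₂ refl) (inj₁ refl) =
  ∨-introʳ (a == b) (∨-introʳ (a == d) (∨-introˡ _ (==-refl b)))
common-endpoint⇒test {a = a} {b = b} {c = c} (inj₂ refl) (inj₂ refl) =
  ∨-introʳ (a == c) (∨-introʳ (a == b) (∨-introʳ (b == c) (==-refl b)))

adjacent-distinct : ∀ {n} (G : SimpleGraph n) {w a} → adj G w a ≡ true → w ≢ a
adjacent-distinct G {w} wa refl with trans (sym wa) (irrefl G w)
... | ()

module TotalGraph {n} (G : SimpleGraph n) where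
  open EdgeList G

  m : ℕ
  m = numEdges G

  endpoints : Fin m → Fin n × Fin n
  endpoints = lookup (edges G)

  vtx : Fin n → Fin (n + m)
  vtx u = u ↑ˡ m

  edg : Fin m → Fin (n + m)
  edg e = n ↑ʳ e

  adj-vtx-vtx : ∀ u v → totalAdj G (vtx u) (vtx v) ≡ adj G u v
  adj-vtx-vtx u v rewrite splitAt-↑ˡ n u m | splitAt-↑ˡ n v m = refl

  adj-vtx-edg : ∀ u e → Incident u (endpoints e) → T (totalAdj G (vtx u) (edg e))
  adj-vtx-edg u e u∈e rewrite splitAt-↑ˡ n u m | splitAt-↑ʳ n m e = incident⇒test u∈e

  adj-edg-edg : ∀ w e f → e ≢ f → Incident w (endpoints e) → Incident w (endpoints f) →
    T (totalAdj G (edg e) (edg f))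
  adj-edg-edg w e f e≢f w∈e w∈f rewrite splitAt-↑ʳ n m e | splitAt-↑ʳ n m f =
    Equivalence.from T-∧ (==-≢ e≢f , common-endpoint⇒test w∈e w∈f)

  vtx<edg : ∀ u e → toℕ (vtx u) < toℕ (edg e)
  vtx<edg u e rewrite toℕ-↑ˡ u m | toℕ-↑ʳ n e = <-≤-trans (toℕ<n u) (m≤m+n n (toℕ e))

  vtx-mono : ∀ {u v} → toℕ u < toℕ v → toℕ (vtx u) < toℕ (vtx v)
  vtx-mono {u} {v} u<v rewrite toℕ-↑ˡ u m | toℕ-↑ˡ v m = u<v

  edg-mono : ∀ {e f} → toℕ e < toℕ f → toℕ (edg e) < toℕ (edg f)
  edg-mono {e} {f} e<f rewrite toℕ-↑ʳ n e | toℕ-↑ʳ n f = +-monoʳ-< n e<f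

  vtx≢edg : ∀ u e → vtx u ≢ edg e
  vtx≢edg u e eq = <-irrefl (cong toℕ eq) (vtx<edg u e)

  edgeTriangle : Fin m → Fin (n + m) × Fin (n + m) × Fin (n + m)
  edgeTriangle e = (vtx (proj₁ (endpoints e)) , vtx (proj₂ (endpoints e)) , edg e)

  edgeTriangle-∈ : ∀ e → edgeTriangle e ∈ triangles (totalAdj G)
  edgeTriangle-∈ e = ∈-triangles (totalAdj G)
    (vtx-mono a<b) (vtx<edg b e)
    (subst T (sym (adj-vtx-vtx a b)) ab)
    (adj-vtx-edg b e (inj₂ refl)) (adj-vtx-edg a e (inj₁ refl))
    where
      a b : Fin n
      a = proj₁ (endpoints e)
      b = proj₂ (endpoints e)
      listed : toℕ a < toℕ b × T (adj G a b)
      listed = ∈-edges⁻ (∈-lookup {xs = edges G} e)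
      a<b : toℕ a < toℕ b
      a<b = proj₁ listed
      ab : T (adj G a b)
      ab = proj₂ listed

  starTriangle : Fin n → Fin m → Fin m → Fin (n + m) × Fin (n + m) × Fin (n + m)
  starTriangle w e f = (vtx w , edg e , edg f)

  starTriangle-∈ : ∀ w e f → toℕ e < toℕ f → Incident w (endpoints e) → Incident w (endpoints f) →
    starTriangle w e f ∈ triangles (totalAdj G)
  starTriangle-∈ w e f e<f w∈e w∈f = ∈-triangles (totalAdj G)
    (vtx<edg w e) (edg-mono e<f)
    (adj-vtx-edg w e w∈e) (adj-edg-edg w e f e≢f w∈e w∈f) (adj-vtx-edg w f w∈f)
    where
      e≢f : e ≢ f
      e≢f refl = <-irrefl refl e<f

  edge-of : ∀ {w a} → adj G w a ≡ true → ∃[ e ] Joins (endpoints e) w a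
  edge-of {w} {a} wa with <-cmp w a
  ... | tri< w<a _ _ = let p = ∈-edges⁺ w<a (Equivalence.from T-≡ wa)
                       in index p , inj₁ (sym (lookup-index p))
  ... | tri≈ _ w≡a _ = ⊥-elim (adjacent-distinct G wa w≡a)
  ... | tri> _ _ a<w = let p = ∈-edges⁺ a<w (Equivalence.from T-≡ (trans (adj-sym G a w) wa))
                       in index p , inj₂ (sym (lookup-index p))

  star : ∀ {w a b} → adj G w a ≡ true → adj G w b ≡ true → a ≢ b →
    Σ (Fin m × Fin m) λ (e , f) → starTriangle w e f ∈ triangles (totalAdj G)
  star {w} {a} {b} wa wb a≢b with edge-of wa | edge-of wb
  ... | e , e-wa | f , f-wb with <-cmp e f
  ... | tri< e<f _ _ = (e , f) , starTriangle-∈ w e f e<f (joins⇒incident e-wa) (joins⇒incident f-wb)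
  ... | tri> _ _ f<e = (f , e) , starTriangle-∈ w f e f<e (joins⇒incident f-wb) (joins⇒incident e-wa)
  ... | tri≈ _ refl _ = ⊥-elim (a≢b (joins-unique (adjacent-distinct G wa) e-wa f-wb))

  more-triangles-than-edges : ∀ {w a b} → adj G w a ≡ true → adj G w b ≡ true → a ≢ b →
    m < h (totalAdj G)
  more-triangles-than-edges wa wb a≢b with star wa wb a≢b
  ... | (e₀ , f₀) , star∈ = injection-into-list (triangles (totalAdj G)) tri tri-∈ tri-inj
    where
      tri : Fin (suc m) → Fin (n + m) × Fin (n + m) × Fin (n + m)
      tri zero = starTriangle _ e₀ f₀
      tri (Fin.suc e) = edgeTriangle e

      tri-∈ : ∀ i → tri i ∈ triangles (totalAdj G)
      tri-∈ zero = star∈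
      tri-∈ (Fin.suc e) = edgeTriangle-∈ e

      -- Star triangles have an edge as second corner, edge triangles a vertex;
      -- edge triangles are told apart by their third corner.
      tri-inj : Injective _≡_ _≡_ tri
      tri-inj {zero} {zero} _ = refl
      tri-inj {zero} {Fin.suc e} eq = ⊥-elim (vtx≢edg _ e₀ (sym (cong (proj₁ ∘ proj₂) eq)))
      tri-inj {Fin.suc e} {zero} eq = ⊥-elim (vtx≢edg _ e₀ (cong (proj₁ ∘ proj₂) eq))
      tri-inj {Fin.suc e} {Fin.suc f} eq = cong Fin.suc (↑ʳ-injective n e f (cong (proj₂ ∘ proj₂) eq))

walk-leaves : ∀ {n} (G : SimpleGraph n) (P : Fin n → Set) → (∀ y → Dec (P y)) →
  ∀ {x z} → Reachable G x z → ¬ P x → P z →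
  ∃[ y ] ∃[ s ] ¬ P y × P s × adj G y s ≡ true
walk-leaves G P P? here ¬Px Pz = ⊥-elim (¬Px Pz)
walk-leaves G P P? {x} (step {v = v} xv walk) ¬Px Pz with P? v
... | yes Pv = x , v , ¬Px , Pv , xv
... | no ¬Pv = walk-leaves G P P? walk ¬Pv Pz

walk-first-edge : ∀ {n} (G : SimpleGraph n) {x y} → Reachable G x y → x ≢ y →
  ∃[ v ] adj G x v ≡ true
walk-first-edge G here x≢y = ⊥-elim (x≢y refl)
walk-first-edge G (step xv _) _ = _ , xv

third-vertex : ∀ {k} (v : Fin (3 + k)) → ∃[ x ] x ≢ zero × x ≢ v
third-vertex v with v ≟ Fin.suc zero
... | yes refl = Fin.suc (Fin.suc zero) , (λ ()) , (λ ())
... | no v≢1 = Fin.suc zero , (λ ()) , (λ 1≡v → v≢1 (sym 1≡v))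

InPair : ∀ {n} → Fin n → Fin n → Fin n → Set
InPair u v y = y ≡ u ⊎ y ≡ v

inPair? : ∀ {n} (u v y : Fin n) → Dec (InPair u v y)
inPair? u v y = (y ≟ u) ⊎-dec (y ≟ v)

-- A connected graph on at least three vertices has a vertex with two
-- distinct neighbours: take an edge 0v and a third vertex x; a walk from x
-- into {0, v} enters it along an edge ys with y ∉ {0, v}, so s has the two
-- distinct neighbours y and the other element of {0, v}.
two-neighbours : ∀ {k} (G : SimpleGraph (3 + k)) → Connected G →
  ∃[ w ] ∃[ a ] ∃[ b ] adj G w a ≡ true × adj G w b ≡ true × a ≢ b
two-neighbours G conn with walk-first-edge G (conn zero (Fin.suc zero)) (λ ())
... | v , 0v with third-vertex v
... | x , x≢0 , x≢v with walk-leaves G (InPair zero v) (inPair? zero v) (conn x zero)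
                          (λ { (inj₁ x≡0) → x≢0 x≡0 ; (inj₂ x≡v) → x≢v x≡v }) (inj₁ refl)
... | y , _ , y∉ , inj₁ refl , y0 =
  zero , v , y , 0v , trans (adj-sym G zero y) y0 , λ v≡y → y∉ (inj₂ (sym v≡y))
... | y , _ , y∉ , inj₂ refl , yv =
  v , zero , y , trans (adj-sym G v zero) 0v , trans (adj-sym G v y) yv , λ 0≡y → y∉ (inj₁ (sym 0≡y))

corollary2p9 : (n : ℕ) (G : SimpleGraph n) → 3 ≤ n → Connected G →
    numEdges G < h (totalAdj G)
corollary2p9 (suc (suc (suc k))) G (s≤s (s≤s (s≤s _))) conn with two-neighbours G conn
... | w , a , b , wa , wb , a≢b = TotalGraph.more-triangles-than-edges G wa wb a≢b
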